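{- For every integer $n\ge 1$, the number of TSSCPP boolean triangles of order $n$ whose rows are weakly decreasing (read from left to right, i.e. $b_{i,j}\ge b_{i,j+1}$ whenever both entries exist) is $n!$. (These are the boolean triangles of the so-called permutation TSSCPP of order $n$.)
   Context: A TSSCPP boolean triangle of order $n$ is an array $\{b_{i,j}\}$ indexed by $1\leq i\leq n-1$, $n-i\leq j\leq n-1$ (row $i$ has the $i$ entries $b_{i,n-i},\dots,b_{i,n-1}$), with entries in $\{0,1\}$, such that for all $j$ and all $i'$ with $j\le i'\le n-1$ the diagonal partial sums satisfy $$1+\sum_{i=j+1}^{i'} b_{i,n-j-1} \;\geq\; \sum_{i=j}^{i'} b_{i,n-j},$$ where sums over index ranges containing no entries of the array are taken to be $0$. Such boolean triangles are in bijection with totally symmetric self-complementary plane partitions in a $2n\times2n\times2n$ box; a permutation TSSCPP is one whose boolean triangle has weakly decreasing rows. -}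

module Defs where

open import Data.Bool using (Bool; true; false; _∧_; if_then_else_)
open import Data.Nat using (ℕ; zero; suc; _+_; _∸_; _≤ᵇ_)
open import Data.List using (List; []; _∷_; _++_; map; applyUpTo)
open import Data.Nat.ListAction using (sum)
open import Data.List using (all)
open import Data.Vec using (Vec; toList)
open import Data.Unit using (⊤)
open import Data.Product using (_×_)

-- A boolean triangle of order n: rows 1 .. n-1, row i having exactly i entries.
-- Triangle (k+2) = (rows 1..k of order k+1 data) × (row k+1, of length k+1).
Triangle : ℕ → Set
Triangle zero = ⊤
Triangle (suc zero) = ⊤
Triangle (suc (suc k)) = Triangle (suc k) × Vec Bool (suc k)

-- the list of rows 1, 2, ..., n-1 (row i lists b_{i,n-i}, ..., b_{i,n-1} left to right)
rows : (n : ℕ) → Triangle n → List (List Bool)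
rows zero _ = []
rows (suc zero) _ = []
rows (suc (suc k)) (t Data.Product., r) = rows (suc k) t ++ (toList r ∷ [])

nth : {A : Set} → List A → ℕ → A → A
nth [] _ d = d
nth (x ∷ xs) zero d = x
nth (x ∷ xs) (suc k) d = nth xs k d

toℕᵇ : Bool → ℕ
toℕᵇ true = 1
toℕᵇ false = 0

-- entry b_{i,c} as a natural number (1 or 0); 0 if (i,c) is not an index of the array
entry : (n : ℕ) → Triangle n → ℕ → ℕ → ℕ
entry n b i c =
  if (1 ≤ᵇ i) ∧ (i ≤ᵇ n ∸ 1) ∧ (n ∸ i ≤ᵇ c) ∧ (c ≤ᵇ n ∸ 1)
  then toℕᵇ (nth (nth (rows n b) (i ∸ 1) []) (c ∸ (n ∸ i)) false)
  else 0

range : ℕ → ℕ → List ℕ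
range a b = applyUpTo (a +_) (suc b ∸ a)

sumFromTo : ℕ → ℕ → (ℕ → ℕ) → ℕ
sumFromTo a b f = sum (map f (range a b))

-- TSSCPP condition: for all j (0 ≤ j ≤ n-1; for j ≥ n there is no i') and all
-- j ≤ i' ≤ n-1:  Σ_{i=j}^{i'} b_{i,n-j}  ≤  1 + Σ_{i=j+1}^{i'} b_{i,n-j-1}
isTSSCPP : (n : ℕ) → Triangle n → Bool
isTSSCPP n b =
  all (λ j → all (λ i' →
        sumFromTo j i' (λ i → entry n b i (n ∸ j))
          ≤ᵇ 1 + sumFromTo (suc j) i' (λ i → entry n b i (n ∸ j ∸ 1)))
      (range j (n ∸ 1)))
    (range 0 (n ∸ 1))

-- a row is weakly decreasing from left to right (true = 1 ≥ false = 0)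
weaklyDecreasing : List Bool → Bool
weaklyDecreasing [] = true
weaklyDecreasing (x ∷ []) = true
weaklyDecreasing (false ∷ true ∷ xs) = false
weaklyDecreasing (x ∷ y ∷ xs) = weaklyDecreasing (y ∷ xs)

rowsWeaklyDecreasing : (n : ℕ) → Triangle n → Bool
rowsWeaklyDecreasing n b = all weaklyDecreasing (rows n b)

isPermutationTSSCPP : (n : ℕ) → Triangle n → Bool
isPermutationTSSCPP n b = isTSSCPP n b ∧ rowsWeaklyDecreasing n b

-- (1) The TSSCPP condition is implied by weakly decreasing rows.  The entry
--     b_{i,n-j} lies to the right of b_{i,n-j-1} in row i, so for i > j a
--     decreasing row gives b_{i,n-j} ≤ b_{i,n-j-1}; comparing the two diagonal
--     sums term by term, and bounding the extra term b_{j,n-j} by 1, yields the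
--     defining inequality.  Hence the permutation TSSCPP triangles are exactly
--     the triangles with weakly decreasing rows.
--
-- (2) Counting triangles with weakly decreasing rows.  A weakly decreasing
--     boolean row of length m is a block of k trues followed by falses, so
--     such rows are in bijection with Fin (m + 1) via k.  The rows of a
--     triangle of order n are chosen independently, with lengths 1, ..., n-1,
--     so by induction the triangles are in bijection with Fin (2 · 3 ⋯ n).
module Submission where

open import Defs
open import Data.Nat using (ℕ; _≤_; _!)
open import Data.Fin using (Fin)
open import Data.Bool using (T)
open import Data.Product using (Σ)
open import Function.Bundles using (_↔_)

open import Data.Nat using (zero; suc; _+_; _∸_; _≤ᵇ_; _<_; z≤n; s≤s; _≤?_)
open import Data.Nat.Properties
open import Data.Nat.ListAction using (sum)
open import Data.Bool using (Bool; true; false; _∧_; if_then_else_)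
open import Data.Bool.Properties using (T-∧; T-irrelevant; ∧-identityʳ; ∧-assoc)
open import Data.List using (List; []; _∷_; _++_; map; applyUpTo; all)
open import Data.List.Relation.Unary.All using (tabulate)
open import Data.List.Relation.Unary.All.Properties using (all⁻)
open import Data.Vec using (Vec; toList) renaming ([] to []ᵥ; _∷_ to _∷ᵥ_)
open import Data.Unit using (tt)
open import Data.Product using (_,_; proj₁; proj₂; _×_)
open import Data.Product.Function.NonDependent.Propositional using (_×-↔_)
open import Data.Fin.Properties using (*↔×)
open import Function using (_∘_)
open import Function.Bundles using (mk↔ₛ′; Equivalence)
open import Function.Properties.Inverse using (↔-trans; ↔-sym)
open import Relation.Binary.PropositionalEquality
open import Relation.Nullary using (yes; no)

∧-intro : ∀ x {y} → T x → T y → T (x ∧ y)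
∧-intro x p q = Equivalence.from (T-∧ {x}) (p , q)

∧-fst : ∀ x {y} → T (x ∧ y) → T x
∧-fst x p = proj₁ (Equivalence.to (T-∧ {x}) p)

∧-snd : ∀ x {y} → T (x ∧ y) → T y
∧-snd x p = proj₂ (Equivalence.to (T-∧ {x}) p)

all-universal : ∀ {A : Set} (p : A → Bool) → (∀ x → T (p x)) → ∀ xs → T (all p xs)
all-universal p h xs = all⁻ p {xs} (tabulate (λ {x} _ → h x))

all-nth : ∀ {A : Set} (p : A → Bool) {d : A} → T (p d) →
  ∀ xs k → T (all p xs) → T (p (nth xs k d))
all-nth p pd [] k _ = pd
all-nth p pd (x ∷ xs) zero h = ∧-fst (p x) h
all-nth p pd (x ∷ xs) (suc k) h = all-nth p pd xs k (∧-snd (p x) h)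

all-∷ʳ : ∀ {A : Set} (p : A → Bool) xs y → all p (xs ++ y ∷ []) ≡ all p xs ∧ p y
all-∷ʳ p [] y = ∧-identityʳ (p y)
all-∷ʳ p (x ∷ xs) y =
  trans (cong (p x ∧_) (all-∷ʳ p xs y)) (sym (∧-assoc (p x) (all p xs) (p y)))

Σ-T-≡ : ∀ {A : Set} (P : A → Bool) {a a' : A} {p : T (P a)} {p' : T (P a')} →
  a ≡ a' → _≡_ {A = Σ A (λ x → T (P x))} (a , p) (a' , p')
Σ-T-≡ P {p = p} {p'} refl = cong (_ ,_) (T-irrelevant p p')

Σ-∧-absorb : ∀ {A : Set} (P Q : A → Bool) → (∀ x → T (Q x) → T (P x)) →
  Σ A (λ x → T (P x ∧ Q x)) ↔ Σ A (λ x → T (Q x))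
Σ-∧-absorb P Q Q⇒P = mk↔ₛ′
  (λ (x , pq) → x , ∧-snd (P x) pq)
  (λ (x , q) → x , ∧-intro (P x) (Q⇒P x q) q)
  (λ _ → Σ-T-≡ Q refl)
  (λ _ → Σ-T-≡ (λ x → P x ∧ Q x) refl)

toℕᵇ≤1 : ∀ b → toℕᵇ b ≤ 1
toℕᵇ≤1 true = s≤s z≤n
toℕᵇ≤1 false = z≤n

weaklyDecreasing-tail : ∀ x y ys →
  T (weaklyDecreasing (x ∷ y ∷ ys)) → T (weaklyDecreasing (y ∷ ys))
weaklyDecreasing-tail true y ys h = h
weaklyDecreasing-tail false false ys h = h

-- In a weakly decreasing row each entry dominates its right neighbour
-- (positions past the end read as false).
weaklyDecreasing-step : ∀ xs k → T (weaklyDecreasing xs) →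
  toℕᵇ (nth xs (suc k) false) ≤ toℕᵇ (nth xs k false)
weaklyDecreasing-step [] k _ = z≤n
weaklyDecreasing-step (x ∷ []) k _ = z≤n
weaklyDecreasing-step (true ∷ y ∷ ys) zero _ = toℕᵇ≤1 y
weaklyDecreasing-step (false ∷ false ∷ ys) zero _ = z≤n
weaklyDecreasing-step (x ∷ y ∷ ys) (suc k) h =
  weaklyDecreasing-step (y ∷ ys) k (weaklyDecreasing-tail x y ys h)

InArray : ℕ → ℕ → ℕ → Set
InArray n i c = 1 ≤ i × i ≤ n ∸ 1 × n ∸ i ≤ c × c ≤ n ∸ 1

entry-inArray : ∀ n b i c → InArray n i c →
  entry n b i c ≡ toℕᵇ (nth (nth (rows n b) (i ∸ 1) []) (c ∸ (n ∸ i)) false)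
entry-inArray n b i c (h₁ , h₂ , h₃ , h₄) =
  if-true (∧-intro (1 ≤ᵇ i) (≤⇒≤ᵇ h₁) (∧-intro (i ≤ᵇ n ∸ 1) (≤⇒≤ᵇ h₂)
            (∧-intro (n ∸ i ≤ᵇ c) (≤⇒≤ᵇ h₃) (≤⇒≤ᵇ h₄))))
  where
  if-true : ∀ {g : Bool} {x : ℕ} → T g → (if g then x else 0) ≡ x
  if-true {true} _ = refl

entry-bound : ∀ n b i c {y} → (InArray n i c → entry n b i c ≤ y) → entry n b i c ≤ y
entry-bound n b i c h with (1 ≤ᵇ i) in e₁ | (i ≤ᵇ n ∸ 1) in e₂
                         | (n ∸ i ≤ᵇ c) in e₃ | (c ≤ᵇ n ∸ 1) in e₄
... | true  | true  | true  | true  = h (from e₁ , from e₂ , from e₃ , from e₄)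
  where
  from : ∀ {u v} → (u ≤ᵇ v) ≡ true → u ≤ v
  from {u} {v} e = ≤ᵇ⇒≤ u v (subst T (sym e) tt)
... | false | _     | _     | _     = z≤n
... | true  | false | _     | _     = z≤n
... | true  | true  | false | _     = z≤n
... | true  | true  | true  | false = z≤n

entry≤1 : ∀ n b i c → entry n b i c ≤ 1
entry≤1 n b i c =
  entry-bound n b i c (λ inA → subst (_≤ 1) (sym (entry-inArray n b i c inA)) (toℕᵇ≤1 _))

entry-antitone : ∀ n b i c → T (rowsWeaklyDecreasing n b) → n ∸ i ≤ c →
  entry n b i (suc c) ≤ entry n b i c
entry-antitone n b i c wd start = entry-bound n b i (suc c) λ (1≤i , i≤ , _ , c<) →
  let inA : InArray n i c
      inA = 1≤i , i≤ , start , <⇒≤ c<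
      row = nth (rows n b) (i ∸ 1) []
      shift : suc c ∸ (n ∸ i) ≡ suc (c ∸ (n ∸ i))
      shift = +-∸-assoc 1 start
  in subst₂ _≤_
       (trans (cong (λ k → toℕᵇ (nth row k false)) (sym shift))
              (sym (entry-inArray n b i (suc c) (1≤i , i≤ , m≤n⇒m≤1+n start , c<))))
       (sym (entry-inArray n b i c inA))
       (weaklyDecreasing-step row _ (all-nth weaklyDecreasing tt (rows n b) (i ∸ 1) wd))

diagonal-step : ∀ n b i j → T (rowsWeaklyDecreasing n b) → j < i →
  entry n b i (n ∸ j) ≤ entry n b i (n ∸ j ∸ 1)
diagonal-step n b i j wd j<i = entry-bound n b i (n ∸ j) λ (_ , i≤ , _ , _) →
  let j<n : j < n
      j<n = ≤-trans j<i (≤-trans i≤ (m∸n≤m n 1))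
      column : n ∸ j ≡ suc (n ∸ j ∸ 1)
      column = trans (sym (m∸n+n≡m (m<n⇒0<n∸m j<n))) (+-comm (n ∸ j ∸ 1) 1)
      start : n ∸ i ≤ n ∸ j ∸ 1
      start = subst (n ∸ i ≤_) (sym (∸-+-assoc n j 1))
                (∸-monoʳ-≤ n (subst (_≤ i) (+-comm 1 j) j<i))
  in subst (λ c → entry n b i c ≤ entry n b i (n ∸ j ∸ 1)) (sym column)
       (entry-antitone n b i (n ∸ j ∸ 1) wd start)

sum-mono : ∀ (f g h₁ h₂ : ℕ → ℕ) → (∀ x → f (h₁ x) ≤ g (h₂ x)) → ∀ d →
  sum (map f (applyUpTo h₁ d)) ≤ sum (map g (applyUpTo h₂ d))
sum-mono f g h₁ h₂ H zero = z≤n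
sum-mono f g h₁ h₂ H (suc d) = +-mono-≤ (H 0) (sum-mono f g (h₁ ∘ suc) (h₂ ∘ suc) (H ∘ suc) d)

diagonal-sums : ∀ (f g : ℕ → ℕ) j i' → f j ≤ 1 → (∀ i → j < i → f i ≤ g i) →
  sumFromTo j i' f ≤ 1 + sumFromTo (suc j) i' g
diagonal-sums f g j i' fj≤1 f≤g with j ≤? i'
... | no j≰i' rewrite m≤n⇒m∸n≡0 (≰⇒> j≰i') = z≤n
... | yes j≤i' rewrite +-∸-assoc 1 j≤i' =
  +-mono-≤ (subst (λ k → f k ≤ 1) (sym (+-identityʳ j)) fj≤1)
           (sum-mono f g (λ x → j + suc x) (suc j +_) shifted (i' ∸ j))
  where
  shifted : ∀ x → f (j + suc x) ≤ g (suc j + x)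
  shifted x = subst (λ k → f (j + suc x) ≤ g k) (+-suc j x) (f≤g (j + suc x) (m<m+n j (s≤s z≤n)))

decreasing⇒TSSCPP : ∀ n b → T (rowsWeaklyDecreasing n b) → T (isTSSCPP n b)
decreasing⇒TSSCPP n b wd = all-universal _ (λ j → all-universal _ (λ i' →
  ≤⇒≤ᵇ (diagonal-sums (λ i → entry n b i (n ∸ j)) (λ i → entry n b i (n ∸ j ∸ 1)) j i'
          (entry≤1 n b j (n ∸ j)) (λ i j<i → diagonal-step n b i j wd j<i)))
  (range j (n ∸ 1))) (range 0 (n ∸ 1))

DecreasingRow : ℕ → Set
DecreasingRow m = Σ (Vec Bool m) (λ v → T (weaklyDecreasing (toList v)))

leadingTrues : ∀ {m} → Vec Bool m → Fin (suc m)
leadingTrues []ᵥ = Fin.zero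
leadingTrues (false ∷ᵥ v) = Fin.zero
leadingTrues (true ∷ᵥ v) = Fin.suc (leadingTrues v)

trueThenFalse : ∀ m → Fin (suc m) → Vec Bool m
trueThenFalse zero _ = []ᵥ
trueThenFalse (suc m) Fin.zero = false ∷ᵥ trueThenFalse m Fin.zero
trueThenFalse (suc m) (Fin.suc k) = true ∷ᵥ trueThenFalse m k

weaklyDecreasing-true∷ : ∀ {m} (v : Vec Bool m) →
  weaklyDecreasing (true ∷ toList v) ≡ weaklyDecreasing (toList v)
weaklyDecreasing-true∷ []ᵥ = refl
weaklyDecreasing-true∷ (y ∷ᵥ v) = refl

trueThenFalse-decreasing : ∀ m k → T (weaklyDecreasing (toList (trueThenFalse m k)))
trueThenFalse-decreasing zero _ = tt
trueThenFalse-decreasing (suc zero) Fin.zero = tt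
trueThenFalse-decreasing (suc (suc m)) Fin.zero = trueThenFalse-decreasing (suc m) Fin.zero
trueThenFalse-decreasing (suc m) (Fin.suc k) =
  subst T (sym (weaklyDecreasing-true∷ (trueThenFalse m k))) (trueThenFalse-decreasing m k)

leadingTrues-trueThenFalse : ∀ m k → leadingTrues (trueThenFalse m k) ≡ k
leadingTrues-trueThenFalse zero Fin.zero = refl
leadingTrues-trueThenFalse (suc m) Fin.zero = refl
leadingTrues-trueThenFalse (suc m) (Fin.suc k) = cong Fin.suc (leadingTrues-trueThenFalse m k)

falses-after-false : ∀ m (v : Vec Bool m) →
  T (weaklyDecreasing (false ∷ toList v)) → v ≡ trueThenFalse m Fin.zero
falses-after-false zero []ᵥ _ = refl
falses-after-false (suc m) (false ∷ᵥ v) h = cong (false ∷ᵥ_) (falses-after-false m v h)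

trueThenFalse-leadingTrues : ∀ m (v : Vec Bool m) → T (weaklyDecreasing (toList v)) →
  trueThenFalse m (leadingTrues v) ≡ v
trueThenFalse-leadingTrues zero []ᵥ _ = refl
trueThenFalse-leadingTrues (suc m) (false ∷ᵥ v) h = cong (false ∷ᵥ_) (sym (falses-after-false m v h))
trueThenFalse-leadingTrues (suc m) (true ∷ᵥ v) h =
  cong (true ∷ᵥ_) (trueThenFalse-leadingTrues m v (subst T (weaklyDecreasing-true∷ v) h))

decreasingRows↔Fin : ∀ m → DecreasingRow m ↔ Fin (suc m)
decreasingRows↔Fin m = mk↔ₛ′
  (leadingTrues ∘ proj₁)
  (λ k → trueThenFalse m k , trueThenFalse-decreasing m k)
  (leadingTrues-trueThenFalse m)
  (λ (v , h) → Σ-T-≡ (weaklyDecreasing ∘ toList) (trueThenFalse-leadingTrues m v h))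

DecreasingTriangle : ℕ → Set
DecreasingTriangle n = Σ (Triangle n) (λ b → T (rowsWeaklyDecreasing n b))

peel-last-row : ∀ k →
  DecreasingTriangle (suc (suc k)) ↔ (DecreasingRow (suc k) × DecreasingTriangle (suc k))
peel-last-row k = mk↔ₛ′
  (λ ((t , r) , h) → let h′ = subst T (split t r) h
                     in (r , ∧-snd (earlier t) h′) , (t , ∧-fst (earlier t) h′))
  (λ ((r , hr) , (t , ht)) → (t , r) , subst T (sym (split t r)) (∧-intro (earlier t) ht hr))
  (λ _ → cong₂ _,_ (Σ-T-≡ (weaklyDecreasing ∘ toList) refl)
                   (Σ-T-≡ (rowsWeaklyDecreasing (suc k)) refl))
  (λ _ → Σ-T-≡ (rowsWeaklyDecreasing (suc (suc k))) refl)
  where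
  earlier : Triangle (suc k) → Bool
  earlier t = rowsWeaklyDecreasing (suc k) t
  split : ∀ t (r : Vec Bool (suc k)) →
    rowsWeaklyDecreasing (suc (suc k)) (t , r) ≡ earlier t ∧ weaklyDecreasing (toList r)
  split t r = all-∷ʳ weaklyDecreasing (rows (suc k) t) (toList r)

decreasingTriangles↔Fin : ∀ k → DecreasingTriangle (suc k) ↔ Fin (suc k !)
decreasingTriangles↔Fin zero =
  mk↔ₛ′ (λ _ → Fin.zero) (λ _ → tt , tt) (λ { Fin.zero → refl ; (Fin.suc ()) }) (λ _ → refl)
decreasingTriangles↔Fin (suc k) =
  ↔-trans (peel-last-row k)
  (↔-trans (decreasingRows↔Fin (suc k) ×-↔ decreasingTriangles↔Fin k)
           (↔-sym (*↔× {suc (suc k)} {suc k !})))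

proposition3p2 : (n : ℕ) → 1 ≤ n →
    Σ (Triangle n) (λ b → T (isPermutationTSSCPP n b)) ↔ Fin (n !)
proposition3p2 (suc k) _ =
  ↔-trans (Σ-∧-absorb (isTSSCPP (suc k)) (rowsWeaklyDecreasing (suc k))
                      (decreasing⇒TSSCPP (suc k)))
          (decreasingTriangles↔Fin k)
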